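{- Let $(V,\mathcal{B})$ be a $(v,k,\lambda)$-BIBD with a $0$-ULSE $\ell$-colouring whose colour classes are $C_1,\dots,C_\ell$. For each $1\leq j\leq \ell$ let $\mathcal{B}_j=\{B\in\mathcal{B}\mid B\cap C_j=\emptyset\}$. If $i\neq j$ and $x\in C_i$, then $x$ lies in exactly \[\frac{\lambda(v-1)}{k-1}-\frac{\lambda v(\ell-1)}{k\ell}\] blocks of $\mathcal{B}_j$.
   Context: For positive integers $v,k,\lambda$ with $2\le k<v$, a $(v,k,\lambda)$-BIBD is a pair $(V,\mathcal{B})$ where $V$ is a set of $v$ points and $\mathcal{B}$ is a collection of $k$-element subsets of $V$ (blocks) such that every pair of distinct points lies in exactly $\lambda$ blocks. An $\ell$-colouring is a surjective map from $V$ onto a set of $\ell$ colours; the colour class of a colour is the set of points mapped to it. A $0$-ULSE $\ell$-colouring is an $\ell$-colouring such that $(\ell-1)$ divides $k$ and in every block exactly one colour does not appear, while each of the other $\ell-1$ colours appears exactly $\frac{k}{\ell-1}$ times in that block. -}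

module Defs where

open import Data.Nat using (ℕ; zero; suc; _+_; _*_; _∸_; _≤_; _<_; NonZero; >-nonZero; z<s; s≤s)
open import Data.Nat.Divisibility using (_∣_)
open import Data.Fin using (Fin)
import Data.Fin as Fin
open import Data.List using (allFin)
import Data.Nat
open import Data.Fin.Subset using (Subset; _∈_; ∣_∣)
open import Data.List using (List; filter; length)
open import Data.List.Membership.Propositional renaming (_∈_ to _∈ᴸ_)
open import Data.Product using (Σ; ∃; _×_; _,_)
open import Data.Integer using (+_)
open import Data.Rational using (ℚ; _-_) renaming (_/_ to _/ℚ_)
open import Relation.Binary.PropositionalEquality using (_≡_; _≢_)
open import Relation.Nullary using (¬_; Dec)
open import Relation.Nullary.Decidable using (¬?)
open import Data.Fin.Properties using (_≟_)
open import Data.Fin.Subset.Properties using (_∈?_)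
open import Data.Bool using (Bool; true; false)
open import Function using (Surjective; _∘_)

-- Blocks: a finite list (multiset, repeated blocks allowed) of subsets of the
-- point set V = Fin v.  A block is a k-element subset.

pairCount : ∀ {v} → List (Subset v) → Fin v → Fin v → ℕ
pairCount ℬ x y = length (filter (λ B → x ∈? B) (filter (λ B → y ∈? B) ℬ))

record IsBIBD (v k λ' : ℕ) (ℬ : List (Subset v)) : Set where
  field
    two≤k      : 2 ≤ k
    k<v        : k < v
    λ-pos      : 1 ≤ λ'
    blockSize  : ∀ {B} → B ∈ᴸ ℬ → ∣ B ∣ ≡ k
    balanced   : ∀ x y → x ≢ y → pairCount ℬ x y ≡ λ'

IsColouring : ∀ {v} ℓ → (Fin v → Fin ℓ) → Set
IsColouring ℓ c = ∀ (j : Fin ℓ) → ∃ λ x → c x ≡ j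

colourCount : ∀ {v ℓ} → (Fin v → Fin ℓ) → Subset v → Fin ℓ → ℕ
colourCount {v} c B j = length (filter (λ x → c x ≟ j) (filter (λ x → x ∈? B) (allFin v)))

record Is0ULSE (v k ℓ : ℕ) (ℬ : List (Subset v)) (c : Fin v → Fin ℓ) : Set where
  field
    colouring : IsColouring ℓ c
    divides   : (ℓ ∸ 1) ∣ k
    perBlock  : ∀ {B} → B ∈ᴸ ℬ →
                Σ (Fin ℓ) λ j →
                  (colourCount c B j ≡ 0) ×
                  (∀ j' → j' ≢ j → colourCount c B j' * (ℓ ∸ 1) ≡ k)

countInBj : ∀ {v ℓ} → List (Subset v) → (Fin v → Fin ℓ) → Fin ℓ → Fin v → ℕ
countInBj ℬ c j x = length (filter (λ B → x ∈? B) (filter (λ B → colourCount c B j Data.Nat.≟ 0) ℬ))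

-- The value  λ(v-1)/(k-1) - λ v (ℓ-1)/(kℓ)  as a rational number
-- (ℓ ∸ 1 is the true ℓ-1 since ℓ ≥ 1 for any surjection from a nonempty V).
-- Denominators k-1 and kℓ are made explicit as suc of something to supply
-- the NonZero instance; the statement only uses it with k = suc (suc k₀), ℓ = suc ℓ₀.
formula : (v k λ' ℓ : ℕ) → 2 ≤ k → 1 ≤ ℓ → ℚ
formula v (suc (suc k₀)) λ' (suc ℓ₀) (s≤s (s≤s _)) (s≤s _) =
  ((+ (λ' * (v ∸ 1))) /ℚ (suc k₀)) - ((+ (λ' * v * ℓ₀)) /ℚ (suc (suc k₀) * suc ℓ₀))

fin⇒pos : ∀ {ℓ} → Fin ℓ → 1 ≤ ℓ
fin⇒pos Fin.zero = s≤s Data.Nat.z≤n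
fin⇒pos (Fin.suc _) = s≤s Data.Nat.z≤n

{-# OPTIONS --safe #-}
-- For a point y and a weight w on points, summing w over the points of the blocks through y
-- counts every z ≠ y exactly λ times and y itself r times.  With w ≡ 1 this gives
-- r (k − 1) = λ (v − 1), so r does not depend on y; with w the indicator of C_j it gives the
-- number of incidences between blocks through y and points of colour j.  The 0-ULSE condition
-- says |B ∩ C_j| (ℓ − 1) + k [B ∩ C_j = ∅] = k for every block, and summed over the blocks
-- through y (none of which misses the colour of y) this forces all colour classes to have
-- the same size v / ℓ.  For x ∉ C_j the same sum reads λ (v / ℓ) (ℓ − 1) + k |𝓑_j(x)| = r k,
-- which is the claimed value once r is substituted.
module Submission where

open import Defs
open import Data.Nat
  using (ℕ; zero; suc; _+_; _*_; _∸_; _≤_; NonZero; >-nonZero; ≢-nonZero⁻¹; s≤s)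
import Data.Nat as ℕ
open import Data.Nat.Properties
  using (+-identityʳ; *-identityʳ; *-zeroʳ; *-comm; *-distribˡ-+; *-distribʳ-+;
         +-cancelʳ-≡; *-cancelʳ-≡; *-cancelˡ-≡; +-comm;
         m≤n+m; m+n∸n≡m; m<n⇒n≢0; <⇒≤; ∸-monoˡ-≤)
open import Data.Nat.Divisibility using (_∣_; 0∣⇒≡0)
open import Data.Nat.Solver using (module +-*-Solver)
import Data.Integer as ℤ
import Data.Integer.Properties as ℤ
open import Data.Rational using (_/_; _-_; -_; fromℚᵘ)
open import Data.Rational.Properties
  using (toℚᵘ-injective; toℚᵘ-fromℚᵘ; toℚᵘ-homo-+; toℚᵘ-homo‿-; fromℚᵘ-cong)
import Data.Rational.Unnormalised as ℚᵘ
import Data.Rational.Unnormalised.Properties as ℚᵘ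
open import Data.Fin using (Fin)
import Data.Fin as Fin
open import Data.Fin.Properties using (_≟_)
open import Data.Fin.Subset using (Subset; _∈_; ∣_∣; inside; outside)
open import Data.Fin.Subset.Properties using (_∈?_)
import Data.Vec as Vec
open import Data.List using (List; []; _∷_; map; filter; length; allFin; tabulate)
open import Data.List.Properties using (map-tabulate; length-tabulate; filter-idem)
open import Data.List.Relation.Unary.Any using (here; there)
open import Data.List.Membership.Propositional using () renaming (_∈_ to _∈ᴸ_)
open import Data.List.Membership.Propositional.Properties
  using (∈-filter⁻; ∈-filter⁺; ∈-allFin; ∈-length)
open import Data.Bool using (if_then_else_)
open import Data.Product using (_×_; _,_; proj₁; proj₂)
open import Function using (_∘_; id)
open import Relation.Nullary using (Dec; yes; no; does; ¬_; contradiction)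
open import Relation.Unary using (Pred; Decidable)
open import Relation.Binary.PropositionalEquality
  using (_≡_; _≢_; refl; sym; trans; cong; cong₂; subst; module ≡-Reasoning)

open ≡-Reasoning

𝟙 : ∀ {p} {P : Set p} → Dec P → ℕ
𝟙 P? = if does P? then 1 else 0

𝟙-yes : ∀ {p} {P : Set p} (P? : Dec P) → P → 𝟙 P? ≡ 1
𝟙-yes (yes _) _ = refl
𝟙-yes (no ¬p) p = contradiction p ¬p

𝟙-no : ∀ {p} {P : Set p} (P? : Dec P) → ¬ P → 𝟙 P? ≡ 0
𝟙-no (yes p) ¬p = contradiction p ¬p
𝟙-no (no _)  _  = refl

∑ : {A : Set} → List A → (A → ℕ) → ℕ
∑ []       f = 0
∑ (x ∷ xs) f = f x + ∑ xs f

syntax ∑ xs (λ x → e) = ∑[ x ∈ xs ] e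

module _ {A : Set} where

  ∑-cong : ∀ (xs : List A) {f g : A → ℕ} → (∀ {x} → x ∈ᴸ xs → f x ≡ g x) → ∑ xs f ≡ ∑ xs g
  ∑-cong []       f≡g = refl
  ∑-cong (x ∷ xs) f≡g = cong₂ _+_ (f≡g (here refl)) (∑-cong xs (f≡g ∘ there))

  ∑-const : ∀ (xs : List A) m → ∑[ _ ∈ xs ] m ≡ length xs * m
  ∑-const []       m = refl
  ∑-const (x ∷ xs) m = cong (m +_) (∑-const xs m)

  ∑-+ : ∀ (xs : List A) (f g : A → ℕ) → ∑[ x ∈ xs ] (f x + g x) ≡ ∑ xs f + ∑ xs g
  ∑-+ []       f g = refl
  ∑-+ (x ∷ xs) f g = begin
    f x + g x + ∑[ y ∈ xs ] (f y + g y) ≡⟨ cong (f x + g x +_) (∑-+ xs f g) ⟩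
    f x + g x + (∑ xs f + ∑ xs g)       ≡⟨ +-*-Solver.solve 4
                                              (λ a b s t → a :+ b :+ (s :+ t) := a :+ s :+ (b :+ t))
                                              refl (f x) (g x) (∑ xs f) (∑ xs g) ⟩
    f x + ∑ xs f + (g x + ∑ xs g)       ∎
    where open +-*-Solver

  ∑-*ˡ : ∀ (xs : List A) m (f : A → ℕ) → ∑[ x ∈ xs ] (m * f x) ≡ m * ∑ xs f
  ∑-*ˡ []       m f = sym (*-zeroʳ m)
  ∑-*ˡ (x ∷ xs) m f = trans (cong (m * f x +_) (∑-*ˡ xs m f)) (sym (*-distribˡ-+ m (f x) (∑ xs f)))

  ∑-*ʳ : ∀ (xs : List A) (f : A → ℕ) m → ∑[ x ∈ xs ] (f x * m) ≡ ∑ xs f * m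
  ∑-*ʳ []       f m = refl
  ∑-*ʳ (x ∷ xs) f m = trans (cong (f x * m +_) (∑-*ʳ xs f m)) (sym (*-distribʳ-+ m (f x) (∑ xs f)))

  module _ {p} {P : Pred A p} (P? : Decidable P) where

    length-filter : ∀ xs → length (filter P? xs) ≡ ∑[ x ∈ xs ] 𝟙 (P? x)
    length-filter []       = refl
    length-filter (x ∷ xs) with P? x
    ... | yes _ = cong suc (length-filter xs)
    ... | no  _ = length-filter xs

    ∑-filter : ∀ xs (f : A → ℕ) → ∑ (filter P? xs) f ≡ ∑[ x ∈ xs ] (𝟙 (P? x) * f x)
    ∑-filter []       f = refl
    ∑-filter (x ∷ xs) f with P? x
    ... | yes _ = cong₂ _+_ (sym (+-identityʳ (f x))) (∑-filter xs f)
    ... | no  _ = ∑-filter xs f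

∑-map : ∀ {A B : Set} (g : A → B) (xs : List A) (f : B → ℕ) → ∑ (map g xs) f ≡ ∑[ x ∈ xs ] f (g x)
∑-map g []       f = refl
∑-map g (x ∷ xs) f = cong (f (g x) +_) (∑-map g xs f)

∑-comm : ∀ {A B : Set} (xs : List A) (ys : List B) (f : A → B → ℕ) →
         ∑[ x ∈ xs ] ∑[ y ∈ ys ] f x y ≡ ∑[ y ∈ ys ] ∑[ x ∈ xs ] f x y
∑-comm []       ys f = sym (trans (∑-const ys 0) (*-zeroʳ (length ys)))
∑-comm (x ∷ xs) ys f = trans (cong (∑ ys (f x) +_) (∑-comm xs ys f)) (sym (∑-+ ys (f x) _))

∑-allFin-suc : ∀ {n} (f : Fin (suc n) → ℕ) →
               ∑ (allFin (suc n)) f ≡ f Fin.zero + ∑[ i ∈ allFin n ] f (Fin.suc i)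
∑-allFin-suc {n} f = cong (f Fin.zero +_) (begin
  ∑ (tabulate Fin.suc) f             ≡⟨ cong (λ is → ∑ is f) (map-tabulate id Fin.suc) ⟨
  ∑ (map Fin.suc (allFin n)) f       ≡⟨ ∑-map Fin.suc (allFin n) f ⟩
  ∑[ i ∈ allFin n ] f (Fin.suc i)    ∎)

∑-allFin-const : ∀ n m → ∑[ _ ∈ allFin n ] m ≡ n * m
∑-allFin-const n m = trans (∑-const (allFin n) m) (cong (_* m) (length-tabulate {n = n} id))

∑-δ : ∀ {n} (x : Fin n) (f : Fin n → ℕ) → ∑[ z ∈ allFin n ] (𝟙 (x ≟ z) * f z) ≡ f x
∑-δ {suc n} Fin.zero f = begin
  ∑[ z ∈ allFin (suc n) ] (𝟙 (Fin.zero ≟ z) * f z) ≡⟨ ∑-allFin-suc (λ z → 𝟙 (Fin.zero ≟ z) * f z) ⟩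
  f Fin.zero + 0 + ∑[ _ ∈ allFin n ] 0              ≡⟨ cong₂ _+_ (+-identityʳ _) (∑-allFin-const n 0) ⟩
  f Fin.zero + n * 0                                ≡⟨ cong (f Fin.zero +_) (*-zeroʳ n) ⟩
  f Fin.zero + 0                                    ≡⟨ +-identityʳ _ ⟩
  f Fin.zero                                        ∎
∑-δ {suc n} (Fin.suc x) f = trans (∑-allFin-suc (λ z → 𝟙 (Fin.suc x ≟ z) * f z)) (∑-δ x (f ∘ Fin.suc))

∑-𝟙-≟ : ∀ {n} (x : Fin n) → ∑[ z ∈ allFin n ] 𝟙 (x ≟ z) ≡ 1
∑-𝟙-≟ {n} x = trans (∑-cong (allFin n) (λ _ → sym (*-identityʳ _))) (∑-δ x (λ _ → 1))

∑-allFin-differ-at : ∀ {n} (x : Fin n) {f g : Fin n → ℕ} → (∀ z → z ≢ x → f z ≡ g z) →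
                     ∑ (allFin n) f + g x ≡ ∑ (allFin n) g + f x
∑-allFin-differ-at {n} x {f} {g} f≡g = begin
  ∑ (allFin n) f + g x                                ≡⟨ cong (∑ (allFin n) f +_) (∑-δ x g) ⟨
  ∑ (allFin n) f + ∑[ z ∈ allFin n ] (𝟙 (x ≟ z) * g z) ≡⟨ ∑-+ (allFin n) f _ ⟨
  ∑[ z ∈ allFin n ] (f z + 𝟙 (x ≟ z) * g z)          ≡⟨ ∑-cong (allFin n) (λ {z} _ → swap z) ⟩
  ∑[ z ∈ allFin n ] (g z + 𝟙 (x ≟ z) * f z)          ≡⟨ ∑-+ (allFin n) g _ ⟩
  ∑ (allFin n) g + ∑[ z ∈ allFin n ] (𝟙 (x ≟ z) * f z) ≡⟨ cong (∑ (allFin n) g +_) (∑-δ x f) ⟩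
  ∑ (allFin n) g + f x                                ∎
  where
  swap : ∀ z → f z + 𝟙 (x ≟ z) * g z ≡ g z + 𝟙 (x ≟ z) * f z
  swap z with x ≟ z
  ... | yes refl = trans (cong (f x +_) (+-identityʳ (g x)))
                         (trans (+-comm (f x) (g x)) (cong (g x +_) (sym (+-identityʳ (f x)))))
  ... | no x≢z   = cong (_+ 0) (f≡g z (x≢z ∘ sym))

weight : ∀ {n} → (Fin n → ℕ) → Subset n → ℕ
weight {n} w B = ∑[ z ∈ allFin n ] (𝟙 (z ∈? B) * w z)

∣p∣≡weight-1 : ∀ {n} (B : Subset n) → ∣ B ∣ ≡ weight (λ _ → 1) B
∣p∣≡weight-1 {zero}  Vec.[]            = refl
∣p∣≡weight-1 {suc n} (inside Vec.∷ B)  =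
  trans (cong suc (∣p∣≡weight-1 B)) (sym (∑-allFin-suc (λ z → 𝟙 (z ∈? inside Vec.∷ B) * 1)))
∣p∣≡weight-1 {suc n} (outside Vec.∷ B) =
  trans (∣p∣≡weight-1 B) (sym (∑-allFin-suc (λ z → 𝟙 (z ∈? outside Vec.∷ B) * 1)))

colourCount≡weight : ∀ {v ℓ} (c : Fin v → Fin ℓ) B j → colourCount c B j ≡ weight (λ z → 𝟙 (c z ≟ j)) B
colourCount≡weight {v} c B j =
  trans (length-filter (λ z → c z ≟ j) (filter (_∈? B) (allFin v)))
        (∑-filter (_∈? B) (allFin v) (λ z → 𝟙 (c z ≟ j)))

colourCount-own : ∀ {v ℓ} (c : Fin v → Fin ℓ) {B y} → y ∈ B → colourCount c B (c y) ≢ 0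
colourCount-own c {B} {y} y∈B =
  m<n⇒n≢0 (∈-length (∈-filter⁺ (λ z → c z ≟ c y) (∈-filter⁺ (_∈? B) (∈-allFin y) y∈B) refl))

replication-from-size-equation : ∀ {r k λ' v} → 1 ≤ k → 1 ≤ v →
  r * k + λ' ≡ λ' * v + r → r * (k ∸ 1) ≡ λ' * (v ∸ 1)
replication-from-size-equation {r} {suc k₁} {λ'} {suc v₁} _ _ eq =
  +-cancelʳ-≡ (r + λ') (r * k₁) (λ' * v₁) (begin
    r * k₁ + (r + λ')
      ≡⟨ solve 3 (λ r k₁ λ' → r :* k₁ :+ (r :+ λ') := r :* (con 1 :+ k₁) :+ λ') refl r k₁ λ' ⟩
    r * suc k₁ + λ'
      ≡⟨ eq ⟩
    λ' * suc v₁ + r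
      ≡⟨ solve 3 (λ r v₁ λ' → λ' :* (con 1 :+ v₁) :+ r := λ' :* v₁ :+ (r :+ λ')) refl r v₁ λ' ⟩
    λ' * v₁ + (r + λ')
      ∎)
  where open +-*-Solver

module Design {v k λ' : ℕ} {ℬ : List (Subset v)} (bibd : IsBIBD v k λ' ℬ) where
  open IsBIBD bibd

  blocksThrough : Fin v → List (Subset v)
  blocksThrough y = filter (y ∈?_) ℬ

  replication : Fin v → ℕ
  replication y = length (blocksThrough y)

  ∈-blocksThrough⁻ : ∀ {y B} → B ∈ᴸ blocksThrough y → B ∈ᴸ ℬ × y ∈ B
  ∈-blocksThrough⁻ {y} = ∈-filter⁻ (y ∈?_) {xs = ℬ}

  pairCount≡∑ : ∀ z y → pairCount ℬ z y ≡ ∑[ B ∈ blocksThrough y ] 𝟙 (z ∈? B)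
  pairCount≡∑ z y = length-filter (z ∈?_) (blocksThrough y)

  pairCount-diagonal : ∀ y → pairCount ℬ y y ≡ replication y
  pairCount-diagonal y = cong length (filter-idem (y ∈?_) ℬ)

  ∑-weight-blocksThrough : ∀ y (w : Fin v → ℕ) →
    ∑[ B ∈ blocksThrough y ] weight w B + λ' * w y ≡ λ' * ∑ (allFin v) w + replication y * w y
  ∑-weight-blocksThrough y w = begin
    ∑[ B ∈ blocksThrough y ] weight w B + λ' * w y
      ≡⟨ cong (_+ λ' * w y) (∑-comm (blocksThrough y) (allFin v) (λ B z → 𝟙 (z ∈? B) * w z)) ⟩
    ∑[ z ∈ allFin v ] ∑[ B ∈ blocksThrough y ] (𝟙 (z ∈? B) * w z) + λ' * w y
      ≡⟨ cong (_+ λ' * w y) (∑-cong (allFin v) (λ {z} _ → through z)) ⟩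
    ∑[ z ∈ allFin v ] (pairCount ℬ z y * w z) + λ' * w y
      ≡⟨ ∑-allFin-differ-at y (λ z z≢y → cong (_* w z) (balanced z y z≢y)) ⟩
    ∑[ z ∈ allFin v ] (λ' * w z) + pairCount ℬ y y * w y
      ≡⟨ cong₂ _+_ (∑-*ˡ (allFin v) λ' w) (cong (_* w y) (pairCount-diagonal y)) ⟩
    λ' * ∑ (allFin v) w + replication y * w y
      ∎
    where
    through : ∀ z → ∑[ B ∈ blocksThrough y ] (𝟙 (z ∈? B) * w z) ≡ pairCount ℬ z y * w z
    through z = trans (∑-*ʳ (blocksThrough y) (λ B → 𝟙 (z ∈? B)) (w z))
                      (cong (_* w z) (sym (pairCount≡∑ z y)))

  replication-number : ∀ y → replication y * (k ∸ 1) ≡ λ' * (v ∸ 1)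
  replication-number y =
    replication-from-size-equation {replication y} {λ' = λ'} (<⇒≤ two≤k) (fin⇒pos y) (begin
    replication y * k + λ'
      ≡⟨ cong₂ _+_ (sym (∑-const (blocksThrough y) k)) (sym (*-identityʳ λ')) ⟩
    ∑[ _ ∈ blocksThrough y ] k + λ' * 1
      ≡⟨ cong (_+ λ' * 1) (∑-cong (blocksThrough y) (λ B∈ → sym (size B∈))) ⟩
    ∑[ B ∈ blocksThrough y ] weight (λ _ → 1) B + λ' * 1
      ≡⟨ ∑-weight-blocksThrough y (λ _ → 1) ⟩
    λ' * ∑[ _ ∈ allFin v ] 1 + replication y * 1
      ≡⟨ cong₂ _+_ (cong (λ' *_) (trans (∑-allFin-const v 1) (*-identityʳ v))) (*-identityʳ _) ⟩
    λ' * v + replication y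
      ∎)
    where
    size : ∀ {B} → B ∈ᴸ blocksThrough y → weight (λ _ → 1) B ≡ k
    size {B} B∈ = trans (sym (∣p∣≡weight-1 B)) (blockSize (proj₁ (∈-blocksThrough⁻ B∈)))

  replication-constant : ∀ y y′ → replication y ≡ replication y′
  replication-constant y y′ = *-cancelʳ-≡ _ _ (k ∸ 1) {{>-nonZero (∸-monoˡ-≤ 1 two≤k)}}
    (trans (replication-number y) (sym (replication-number y′)))

∣-nonZero : ∀ {m n} .{{_ : NonZero n}} → m ∣ n → NonZero m
∣-nonZero {zero}  {n} 0∣n = contradiction (0∣⇒≡0 0∣n) (≢-nonZero⁻¹ n)
∣-nonZero {suc m}     _   = _

module Colouring {v k λ' ℓ : ℕ} {ℬ : List (Subset v)} (bibd : IsBIBD v k λ' ℬ)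
                 (c : Fin v → Fin ℓ) (ulse : Is0ULSE v k ℓ ℬ c) where
  open IsBIBD bibd
  open Is0ULSE ulse
  open Design bibd

  instance
    λ'-nonZero : NonZero λ'
    λ'-nonZero = >-nonZero λ-pos

    -- ℓ ≥ 2 is forced by (ℓ − 1) ∣ k with k ≥ 2, not by the existence of two colours.
    ℓ∸1-nonZero : NonZero (ℓ ∸ 1)
    ℓ∸1-nonZero = ∣-nonZero {{>-nonZero (<⇒≤ two≤k)}} divides

  absent? : ∀ j B → Dec (colourCount c B j ≡ 0)
  absent? j B = colourCount c B j ℕ.≟ 0

  classSize : Fin ℓ → ℕ
  classSize j = ∑[ z ∈ allFin v ] 𝟙 (c z ≟ j)

  colourIncidence : Fin v → Fin ℓ → ℕ
  colourIncidence x j = ∑[ B ∈ blocksThrough x ] colourCount c B j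

  colourIncidence-equation : ∀ x j →
    colourIncidence x j + λ' * 𝟙 (c x ≟ j) ≡ λ' * classSize j + replication x * 𝟙 (c x ≟ j)
  colourIncidence-equation x j =
    trans (cong (_+ λ' * 𝟙 (c x ≟ j)) (∑-cong (blocksThrough x) (λ {B} _ → colourCount≡weight c B j)))
          (∑-weight-blocksThrough x (λ z → 𝟙 (c z ≟ j)))

  colourIncidence-own : ∀ y → colourIncidence y (c y) + λ' ≡ λ' * classSize (c y) + replication y
  colourIncidence-own y = begin
    colourIncidence y (c y) + λ'
      ≡⟨ cong (colourIncidence y (c y) +_) (sym (*-identityʳ λ')) ⟩
    colourIncidence y (c y) + λ' * 1
      ≡⟨ subst (λ t → colourIncidence y (c y) + λ' * t ≡ λ' * classSize (c y) + replication y * t)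
               (𝟙-yes (c y ≟ c y) refl) (colourIncidence-equation y (c y)) ⟩
    λ' * classSize (c y) + replication y * 1
      ≡⟨ cong (λ' * classSize (c y) +_) (*-identityʳ _) ⟩
    λ' * classSize (c y) + replication y
      ∎

  colourIncidence-other : ∀ {x j} → c x ≢ j → colourIncidence x j ≡ λ' * classSize j
  colourIncidence-other {x} {j} cx≢j = begin
    colourIncidence x j
      ≡⟨ +-identityʳ _ ⟨
    colourIncidence x j + 0
      ≡⟨ cong (colourIncidence x j +_) (*-zeroʳ λ') ⟨
    colourIncidence x j + λ' * 0
      ≡⟨ subst (λ t → colourIncidence x j + λ' * t ≡ λ' * classSize j + replication x * t)
               (𝟙-no (c x ≟ j) cx≢j) (colourIncidence-equation x j) ⟩
    λ' * classSize j + replication x * 0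
      ≡⟨ cong (λ' * classSize j +_) (*-zeroʳ (replication x)) ⟩
    λ' * classSize j + 0
      ≡⟨ +-identityʳ _ ⟩
    λ' * classSize j
      ∎

  block-equation : ∀ {B} → B ∈ᴸ ℬ → ∀ j →
    colourCount c B j * (ℓ ∸ 1) + 𝟙 (absent? j B) * k ≡ k
  block-equation {B} B∈ℬ j with absent? j B
  ... | yes absent = cong₂ _+_ (cong (_* (ℓ ∸ 1)) absent)
                               (trans (cong (_* k) (𝟙-yes (absent? j B) absent)) (+-identityʳ k))
  ... | no present with perBlock B∈ℬ
  ...   | j₀ , missing , others = trans (cong (colourCount c B j * (ℓ ∸ 1) +_)
                                              (cong (_* k) (𝟙-no (absent? j B) present)))
                                        (trans (+-identityʳ _) (others j λ { refl → present missing }))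

  countInBj≡∑ : ∀ j x → countInBj ℬ c j x ≡ ∑[ B ∈ blocksThrough x ] 𝟙 (absent? j B)
  countInBj≡∑ j x = begin
    countInBj ℬ c j x
      ≡⟨ length-filter (x ∈?_) (filter (absent? j) ℬ) ⟩
    ∑[ B ∈ filter (absent? j) ℬ ] 𝟙 (x ∈? B)
      ≡⟨ ∑-filter (absent? j) ℬ (λ B → 𝟙 (x ∈? B)) ⟩
    ∑[ B ∈ ℬ ] (𝟙 (absent? j B) * 𝟙 (x ∈? B))
      ≡⟨ ∑-cong ℬ (λ {B} _ → *-comm (𝟙 (absent? j B)) (𝟙 (x ∈? B))) ⟩
    ∑[ B ∈ ℬ ] (𝟙 (x ∈? B) * 𝟙 (absent? j B))
      ≡⟨ ∑-filter (x ∈?_) ℬ (λ B → 𝟙 (absent? j B)) ⟨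
    ∑[ B ∈ blocksThrough x ] 𝟙 (absent? j B)
      ∎

  incidence-equation : ∀ x j → colourIncidence x j * (ℓ ∸ 1) + countInBj ℬ c j x * k ≡ replication x * k
  incidence-equation x j = begin
    colourIncidence x j * (ℓ ∸ 1) + countInBj ℬ c j x * k
      ≡⟨ cong₂ _+_ (∑-*ʳ (blocksThrough x) (λ B → colourCount c B j) (ℓ ∸ 1))
                   (trans (∑-*ʳ (blocksThrough x) (λ B → 𝟙 (absent? j B)) k)
                          (cong (_* k) (sym (countInBj≡∑ j x)))) ⟨
    ∑[ B ∈ blocksThrough x ] (colourCount c B j * (ℓ ∸ 1)) + ∑[ B ∈ blocksThrough x ] (𝟙 (absent? j B) * k)
      ≡⟨ ∑-+ (blocksThrough x) _ _ ⟨
    ∑[ B ∈ blocksThrough x ] (colourCount c B j * (ℓ ∸ 1) + 𝟙 (absent? j B) * k)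
      ≡⟨ ∑-cong (blocksThrough x) (λ B∈ → block-equation (proj₁ (∈-blocksThrough⁻ B∈)) j) ⟩
    ∑[ _ ∈ blocksThrough x ] k
      ≡⟨ ∑-const (blocksThrough x) k ⟩
    replication x * k
      ∎

  countInBj-own : ∀ y → countInBj ℬ c (c y) y ≡ 0
  countInBj-own y = begin
    countInBj ℬ c (c y) y
      ≡⟨ countInBj≡∑ (c y) y ⟩
    ∑[ B ∈ blocksThrough y ] 𝟙 (absent? (c y) B)
      ≡⟨ ∑-cong (blocksThrough y) (λ B∈ → 𝟙-no (absent? (c y) _)
                                                (colourCount-own c (proj₂ (∈-blocksThrough⁻ B∈)))) ⟩
    ∑[ _ ∈ blocksThrough y ] 0
      ≡⟨ ∑-const (blocksThrough y) 0 ⟩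
    replication y * 0
      ≡⟨ *-zeroʳ (replication y) ⟩
    0 ∎

  classSize-equation : ∀ y →
    (λ' * classSize (c y) + replication y) * (ℓ ∸ 1) ≡ replication y * k + λ' * (ℓ ∸ 1)
  classSize-equation y = begin
    (λ' * classSize (c y) + replication y) * (ℓ ∸ 1)
      ≡⟨ cong (_* (ℓ ∸ 1)) (colourIncidence-own y) ⟨
    (colourIncidence y (c y) + λ') * (ℓ ∸ 1)
      ≡⟨ *-distribʳ-+ (ℓ ∸ 1) (colourIncidence y (c y)) λ' ⟩
    colourIncidence y (c y) * (ℓ ∸ 1) + λ' * (ℓ ∸ 1)
      ≡⟨ cong (_+ λ' * (ℓ ∸ 1)) own-incidence ⟩
    replication y * k + λ' * (ℓ ∸ 1)
      ∎
    where
    own-incidence : colourIncidence y (c y) * (ℓ ∸ 1) ≡ replication y * k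
    own-incidence = trans (sym (+-identityʳ _))
      (subst (λ n → colourIncidence y (c y) * (ℓ ∸ 1) + n * k ≡ replication y * k)
             (countInBj-own y) (incidence-equation y (c y)))

  classSize-constant : ∀ j j′ → classSize j ≡ classSize j′
  classSize-constant j j′ with colouring j | colouring j′
  ... | y , refl | y′ , refl =
    *-cancelˡ-≡ _ _ λ' (+-cancelʳ-≡ (replication y) _ _ (*-cancelʳ-≡ _ _ (ℓ ∸ 1) (begin
      (λ' * classSize (c y) + replication y) * (ℓ ∸ 1)
        ≡⟨ classSize-equation y ⟩
      replication y * k + λ' * (ℓ ∸ 1)
        ≡⟨ cong (λ r → r * k + λ' * (ℓ ∸ 1)) (replication-constant y y′) ⟩
      replication y′ * k + λ' * (ℓ ∸ 1)
        ≡⟨ classSize-equation y′ ⟨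
      (λ' * classSize (c y′) + replication y′) * (ℓ ∸ 1)
        ≡⟨ cong (λ r → (λ' * classSize (c y′) + r) * (ℓ ∸ 1)) (replication-constant y′ y) ⟩
      (λ' * classSize (c y′) + replication y) * (ℓ ∸ 1)
        ∎)))

  ∑-classSize : ∑ (allFin ℓ) classSize ≡ v
  ∑-classSize = begin
    ∑[ j ∈ allFin ℓ ] ∑[ z ∈ allFin v ] 𝟙 (c z ≟ j)
      ≡⟨ ∑-comm (allFin ℓ) (allFin v) (λ j z → 𝟙 (c z ≟ j)) ⟩
    ∑[ z ∈ allFin v ] ∑[ j ∈ allFin ℓ ] 𝟙 (c z ≟ j)
      ≡⟨ ∑-cong (allFin v) (λ {z} _ → ∑-𝟙-≟ (c z)) ⟩
    ∑[ _ ∈ allFin v ] 1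
      ≡⟨ ∑-allFin-const v 1 ⟩
    v * 1
      ≡⟨ *-identityʳ v ⟩
    v ∎

  v≡ℓ*classSize : ∀ j → v ≡ ℓ * classSize j
  v≡ℓ*classSize j = begin
    v                                 ≡⟨ ∑-classSize ⟨
    ∑ (allFin ℓ) classSize            ≡⟨ ∑-cong (allFin ℓ) (λ {j′} _ → classSize-constant j′ j) ⟩
    ∑[ _ ∈ allFin ℓ ] classSize j     ≡⟨ ∑-allFin-const ℓ (classSize j) ⟩
    ℓ * classSize j                   ∎

  countInBj-cleared : ∀ {x j} → c x ≢ j →
    countInBj ℬ c j x * ((k ∸ 1) * (k * ℓ)) + λ' * v * (ℓ ∸ 1) * (k ∸ 1) ≡ λ' * (v ∸ 1) * (k * ℓ)
  countInBj-cleared {x} {j} cx≢j = begin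
    n * ((k ∸ 1) * (k * ℓ)) + λ' * v * (ℓ ∸ 1) * (k ∸ 1)
      ≡⟨ cong (λ t → n * ((k ∸ 1) * (k * ℓ)) + λ' * t * (ℓ ∸ 1) * (k ∸ 1)) (v≡ℓ*classSize j) ⟩
    n * ((k ∸ 1) * (k * ℓ)) + λ' * (ℓ * classSize j) * (ℓ ∸ 1) * (k ∸ 1)
      ≡⟨ solve 7 (λ n k₁ k ℓ λ' C ℓ₁ → n :* (k₁ :* (k :* ℓ)) :+ λ' :* (ℓ :* C) :* ℓ₁ :* k₁
                                       := (λ' :* C :* ℓ₁ :+ n :* k) :* (k₁ :* ℓ))
               refl n (k ∸ 1) k ℓ λ' (classSize j) (ℓ ∸ 1) ⟩
    (λ' * classSize j * (ℓ ∸ 1) + n * k) * ((k ∸ 1) * ℓ)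
      ≡⟨ cong (_* ((k ∸ 1) * ℓ)) other-colour ⟩
    replication x * k * ((k ∸ 1) * ℓ)
      ≡⟨ solve 4 (λ r k k₁ ℓ → r :* k :* (k₁ :* ℓ) := r :* k₁ :* (k :* ℓ))
               refl (replication x) k (k ∸ 1) ℓ ⟩
    replication x * (k ∸ 1) * (k * ℓ)
      ≡⟨ cong (_* (k * ℓ)) (replication-number x) ⟩
    λ' * (v ∸ 1) * (k * ℓ)
      ∎
    where
    open +-*-Solver
    n = countInBj ℬ c j x
    other-colour : λ' * classSize j * (ℓ ∸ 1) + n * k ≡ replication x * k
    other-colour = subst (λ U → U * (ℓ ∸ 1) + n * k ≡ replication x * k)
                         (colourIncidence-other cx≢j) (incidence-equation x j)

fromℚᵘ-homo-minus : ∀ p q → fromℚᵘ (p ℚᵘ.- q) ≡ fromℚᵘ p - fromℚᵘ q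
fromℚᵘ-homo-minus p q = toℚᵘ-injective (ℚᵘ.≃-trans (toℚᵘ-fromℚᵘ (p ℚᵘ.- q)) (ℚᵘ.≃-sym (ℚᵘ.≃-trans
  (toℚᵘ-homo-+ (fromℚᵘ p) (- fromℚᵘ q))
  (ℚᵘ.+-cong (toℚᵘ-fromℚᵘ p) (ℚᵘ.≃-trans (toℚᵘ-homo‿- (fromℚᵘ q)) (ℚᵘ.-‿cong (toℚᵘ-fromℚᵘ q)))))))

-- Imported only here: once ℤ's prefix +_ is in scope, sections such as (m +_) of ℕ's _+_ no
-- longer parse.
open import Data.Integer using (+_)

-- The two sides are literally the cross products of  n / 1 ≃ a / d − b / e  in ℚᵘ.
cross-multiplied : ∀ {n a b d e} → n * (d * e) + b * d ≡ a * e →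
  + n ℤ.* + (d * e) ≡ (+ a ℤ.* + e ℤ.+ (ℤ.- + b) ℤ.* + d) ℤ.* + 1
cross-multiplied {n} {a} {b} {d} {e} eq = begin
  + n ℤ.* + (d * e)                   ≡⟨ ℤ.pos-* n (d * e) ⟨
  + (n * (d * e))                     ≡⟨ cong +_ (m+n∸n≡m _ (b * d)) ⟨
  + (n * (d * e) + b * d ∸ b * d)     ≡⟨ ℤ.⊖-≥ (m≤n+m (b * d) (n * (d * e))) ⟨
  (n * (d * e) + b * d) ℤ.⊖ (b * d)   ≡⟨ cong (ℤ._⊖ (b * d)) eq ⟩
  (a * e) ℤ.⊖ (b * d)                 ≡⟨ ℤ.m-n≡m⊖n (a * e) (b * d) ⟨
  + (a * e) ℤ.+ ℤ.- + (b * d)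
    ≡⟨ cong₂ ℤ._+_ (ℤ.pos-* a e) (trans (cong ℤ.-_ (ℤ.pos-* b d)) (ℤ.neg-distribˡ-* (+ b) (+ d))) ⟩
  + a ℤ.* + e ℤ.+ (ℤ.- + b) ℤ.* + d
    ≡⟨ ℤ.*-identityʳ _ ⟨
  (+ a ℤ.* + e ℤ.+ (ℤ.- + b) ℤ.* + d) ℤ.* + 1
    ∎

fraction-difference : ∀ n a b d e .{{_ : NonZero d}} .{{_ : NonZero e}} →
  n * (d * e) + b * d ≡ a * e → (+ n) / 1 ≡ (+ a) / d - (+ b) / e
fraction-difference n a b (suc d₁) (suc e₁) eq = begin
  fromℚᵘ (ℚᵘ.mkℚᵘ (+ n) 0)
    ≡⟨ fromℚᵘ-cong {ℚᵘ.mkℚᵘ (+ n) 0} {a/d ℚᵘ.- b/e}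
                   (ℚᵘ.*≡* (cross-multiplied {n} {a} {b} {suc d₁} {suc e₁} eq)) ⟩
  fromℚᵘ (a/d ℚᵘ.- b/e)
    ≡⟨ fromℚᵘ-homo-minus a/d b/e ⟩
  fromℚᵘ a/d - fromℚᵘ b/e
    ∎
  where
  a/d = ℚᵘ.mkℚᵘ (+ a) d₁
  b/e = ℚᵘ.mkℚᵘ (+ b) e₁

formula-from-cleared : ∀ {v k λ' ℓ} n (two≤k : 2 ≤ k) (1≤ℓ : 1 ≤ ℓ) →
  n * ((k ∸ 1) * (k * ℓ)) + λ' * v * (ℓ ∸ 1) * (k ∸ 1) ≡ λ' * (v ∸ 1) * (k * ℓ) →
  (+ n) / 1 ≡ formula v k λ' ℓ two≤k 1≤ℓ
formula-from-cleared {v} {k} {λ'} {ℓ} n (s≤s (s≤s _)) (s≤s _) =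
  fraction-difference n (λ' * (v ∸ 1)) (λ' * v * (ℓ ∸ 1)) (k ∸ 1) (k * ℓ)

lemma3p8 : (v k λ' ℓ : ℕ) (ℬ : List (Subset v)) (bibd : IsBIBD v k λ' ℬ)
    (c : Fin v → Fin ℓ) → Is0ULSE v k ℓ ℬ c →
    (i j : Fin ℓ) → i ≢ j → (x : Fin v) → c x ≡ i →
    (+ countInBj ℬ c j x) / 1 ≡ formula v k λ' ℓ (IsBIBD.two≤k bibd) (fin⇒pos i)
lemma3p8 v k λ' ℓ ℬ bibd c ulse i j i≢j x refl =
  formula-from-cleared (countInBj ℬ c j x) (IsBIBD.two≤k bibd) (fin⇒pos (c x)) (countInBj-cleared i≢j)
  where open Colouring bibd c ulse
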